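{- Let $M$ be a positive integer, $K=\lceil\log M\rceil$, and $A_0=2^K-M$, and assume $A_0>0$. Then $$\frac{2^K}{M}\Big(H_1(M/2^K)+\nu(1-M/2^K)\Big)<\frac{A_0}{M}\big(K+3-\lfloor\log A_0\rfloor\big).$$
   Context: All logarithms are base 2. For real $x\ge0$ and integer $d$, $\epsilon_d(x)=\lfloor2^dx\rfloor\bmod2$, and for $x\in[0,1]$, $\nu(x)=\sum_{d\ge0}d\,\epsilon_d(x)2^{ -d}$. $H_1(x)=x\log(1/x)$ with $H_1(0)=0$. In the paper this is applied with $M=c_Km$, the amplified weight sum of a rejection sampler, and $A_0$ its rejection weight. -}

module Defs where

open import Data.Nat using (ℕ; zero; suc; _+_; _*_; _∸_; _^_)
open import Data.Nat.DivMod using (_/_; _%_)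
open import Data.Nat.Properties using (m^n≢0)

-- ε_d(a / 2^K) = ⌊2^d · a / 2^K⌋ mod 2  (binary digit of the dyadic rational a/2^K)
ε : ℕ → ℕ → ℕ → ℕ
ε K d a = ((2 ^ d * a) / (2 ^ K)) {{m^n≢0 2 K}} % 2

Σ≤ : ℕ → (ℕ → ℕ) → ℕ
Σ≤ zero    f = f 0
Σ≤ (suc n) f = Σ≤ n f + f (suc n)

-- νScaled K a = 2^K · ν(a / 2^K) = Σ_{d=0}^{K} d · ε_d(a/2^K) · 2^(K-d)
-- (for d > K the digit ε_d(a/2^K) = ⌊2^(d-K) a⌋ mod 2 vanishes, so the
-- infinite series defining ν is exactly this finite sum)
νScaled : ℕ → ℕ → ℕ
νScaled K a = Σ≤ K (λ d → d * ε K d a * 2 ^ (K ∸ d))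

{-# OPTIONS --safe #-}
-- Write K = ⌈log₂ M⌉, A = 2^K − M, L = ⌊log₂ A⌋ and V = 2^K ν(A/2^K). Since 2^K = M + A and
-- (1 + 1/n)^m ≤ (2n + m)/(2n − m) ≤ 3 for m ≤ n, the factor 2^(MK) = (M + A)^M is at most
-- 3^A M^M ≤ 2^(2A) M^M, so it suffices that V + 2A < A(K + 3 − L). Weighting each binary digit
-- of A/2^K by its position gives KA − V = Σ_{j=1}^{K} 2^j ⌊A/2^j⌋, and halving A repeatedly
-- shows that A plus this sum exceeds L(A + 1), which yields the bound.
module Submission where

open import Defs
open import Data.Nat using (ℕ; _+_; _*_; _∸_; _^_; _<_; NonZero)
open import Data.Nat.Logarithm using (⌊log₂_⌋; ⌈log₂_⌉)
open import Data.Nat using (zero; suc; _≤_; z≤n; s≤s; ⌊_/2⌋)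
open import Data.Nat.Properties
open import Data.Nat.DivMod using (_/_; _%_; /-congˡ; m≡m%n+[m/n]*n; m%n<n; m*n/n≡m;
  m*n/o*n≡m/o; m/n/o≡m/[n*o]; m≥n⇒m/n>0; m/n≡1+[m∸n]/n)
open import Data.Nat.Logarithm using (⌊log₂⌋-mono-≤; ⌊log₂[2^n]⌋≡n)
open import Data.Nat.Logarithm.Core using (⌊log2⌋-acc-irrelevant)
open import Data.Nat.Tactic.RingSolver using (solve-∀)
open import Data.Product using (_,_)
open import Function using (_∘_)
open import Relation.Binary.PropositionalEquality

Σ≤-cong : ∀ n {f g : ℕ → ℕ} → (∀ {d} → d ≤ n → f d ≡ g d) → Σ≤ n f ≡ Σ≤ n g
Σ≤-cong zero    f≗g = f≗g z≤n
Σ≤-cong (suc n) f≗g = cong₂ _+_ (Σ≤-cong n (f≗g ∘ m≤n⇒m≤1+n)) (f≗g ≤-refl)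

Σ≤-*-distribˡ : ∀ c n (f : ℕ → ℕ) → Σ≤ n (λ d → c * f d) ≡ c * Σ≤ n f
Σ≤-*-distribˡ c zero    f = refl
Σ≤-*-distribˡ c (suc n) f = begin
  Σ≤ n (λ d → c * f d) + c * f (suc n) ≡⟨ cong (_+ c * f (suc n)) (Σ≤-*-distribˡ c n f) ⟩
  c * Σ≤ n f + c * f (suc n)           ≡⟨ *-distribˡ-+ c (Σ≤ n f) (f (suc n)) ⟨
  c * (Σ≤ n f + f (suc n))             ∎
  where open ≡-Reasoning

dyadicFloor : ℕ → ℕ → ℕ → ℕ
dyadicFloor K d a = ((2 ^ d * a) / 2 ^ K) {{m^n≢0 2 K}}

dyadicFloor-suc/2 : ∀ K d a → dyadicFloor K (suc d) a / 2 ≡ dyadicFloor K d a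
dyadicFloor-suc/2 K d a = begin
  2 ^ suc d * a / 2 ^ K / 2   ≡⟨ m/n/o≡m/[n*o] (2 ^ suc d * a) (2 ^ K) 2 ⟩
  2 ^ suc d * a / (2 ^ K * 2) ≡⟨ /-congˡ (2*p*a≡p*a*2 (2 ^ d) a) ⟩
  2 ^ d * a * 2 / (2 ^ K * 2) ≡⟨ m*n/o*n≡m/o (2 ^ d * a) 2 (2 ^ K) ⟩
  2 ^ d * a / 2 ^ K           ∎
  where
  open ≡-Reasoning
  instance
    2^K≢0 : NonZero (2 ^ K)
    2^K≢0 = m^n≢0 2 K
    2^K*2≢0 : NonZero (2 ^ K * 2)
    2^K*2≢0 = m*n≢0 (2 ^ K) 2
  2*p*a≡p*a*2 : ∀ p a → 2 * p * a ≡ p * a * 2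
  2*p*a≡p*a*2 = solve-∀

dyadicFloor-suc : ∀ K d a → dyadicFloor K (suc d) a ≡ ε K (suc d) a + dyadicFloor K d a * 2
dyadicFloor-suc K d a = begin
  dyadicFloor K (suc d) a                              ≡⟨ m≡m%n+[m/n]*n (dyadicFloor K (suc d) a) 2 ⟩
  ε K (suc d) a + dyadicFloor K (suc d) a / 2 * 2      ≡⟨ cong (λ q → ε K (suc d) a + q * 2) (dyadicFloor-suc/2 K d a) ⟩
  ε K (suc d) a + dyadicFloor K d a * 2                ∎
  where open ≡-Reasoning

dyadicFloor-self : ∀ K a → dyadicFloor K K a ≡ a
dyadicFloor-self K a = trans (/-congˡ (*-comm (2 ^ K) a)) (m*n/n≡m a (2 ^ K))
  where instance
    2^K≢0 : NonZero (2 ^ K)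
    2^K≢0 = m^n≢0 2 K

νPartial : ℕ → ℕ → ℕ → ℕ
νPartial K a n = Σ≤ n (λ d → d * ε K d a * 2 ^ (n ∸ d))

νPartial-suc : ∀ K a n → νPartial K a (suc n) ≡ 2 * νPartial K a n + suc n * ε K (suc n) a
νPartial-suc K a n = cong₂ _+_ earlier-digits-doubled last-digit
  where
  open ≡-Reasoning
  term-doubled : ∀ {d} → d ≤ n → d * ε K d a * 2 ^ (suc n ∸ d) ≡ 2 * (d * ε K d a * 2 ^ (n ∸ d))
  term-doubled {d} d≤n = begin
    d * ε K d a * 2 ^ (suc n ∸ d)      ≡⟨ cong (λ k → d * ε K d a * 2 ^ k) (+-∸-assoc 1 d≤n) ⟩
    d * ε K d a * (2 * 2 ^ (n ∸ d))    ≡⟨ x*y*[2*z]≡2*[x*y*z] d (ε K d a) (2 ^ (n ∸ d)) ⟩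
    2 * (d * ε K d a * 2 ^ (n ∸ d))    ∎
    where
    x*y*[2*z]≡2*[x*y*z] : ∀ x y z → x * y * (2 * z) ≡ 2 * (x * y * z)
    x*y*[2*z]≡2*[x*y*z] = solve-∀
  earlier-digits-doubled : Σ≤ n (λ d → d * ε K d a * 2 ^ (suc n ∸ d)) ≡ 2 * νPartial K a n
  earlier-digits-doubled = trans (Σ≤-cong n term-doubled) (Σ≤-*-distribˡ 2 n _)
  last-digit : suc n * ε K (suc n) a * 2 ^ (n ∸ n) ≡ suc n * ε K (suc n) a
  last-digit = trans (cong (λ k → suc n * ε K (suc n) a * 2 ^ k) (n∸n≡0 n)) (*-identityʳ _)

-- floorSum n q = Σ_{j=1}^{n} 2^j ⌊q / 2^j⌋
floorSum : ℕ → ℕ → ℕ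
floorSum zero    q = 0
floorSum (suc n) q = 2 * floorSum n (q / 2) + 2 * (q / 2)

νPartial+floorSum≡n*dyadicFloor : ∀ K a n →
  νPartial K a n + floorSum n (dyadicFloor K n a) ≡ n * dyadicFloor K n a
νPartial+floorSum≡n*dyadicFloor K a zero    = refl
νPartial+floorSum≡n*dyadicFloor K a (suc n) = begin
  νPartial K a (suc n) + (2 * floorSum n (q′ / 2) + 2 * (q′ / 2))
    ≡⟨ cong₂ (λ v h → v + (2 * floorSum n h + 2 * h)) (νPartial-suc K a n) (dyadicFloor-suc/2 K n a) ⟩
  (2 * νPartial K a n + suc n * e) + (2 * floorSum n q + 2 * q)
    ≡⟨ regroup (νPartial K a n) (floorSum n q) e q n ⟩
  2 * (νPartial K a n + floorSum n q) + suc n * e + 2 * q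
    ≡⟨ cong (λ x → 2 * x + suc n * e + 2 * q) (νPartial+floorSum≡n*dyadicFloor K a n) ⟩
  2 * (n * q) + suc n * e + 2 * q
    ≡⟨ collect e q n ⟩
  suc n * (e + q * 2)
    ≡⟨ cong (suc n *_) (dyadicFloor-suc K n a) ⟨
  suc n * q′ ∎
  where
  open ≡-Reasoning
  q  = dyadicFloor K n a
  q′ = dyadicFloor K (suc n) a
  e  = ε K (suc n) a
  regroup : ∀ v s e q n → (2 * v + suc n * e) + (2 * s + 2 * q) ≡ 2 * (v + s) + suc n * e + 2 * q
  regroup = solve-∀
  collect : ∀ e q n → 2 * (n * q) + suc n * e + 2 * q ≡ suc n * (e + q * 2)
  collect = solve-∀

νScaled+floorSum≡K*a : ∀ K a → νScaled K a + floorSum K a ≡ K * a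
νScaled+floorSum≡K*a K a =
  subst (λ q → νScaled K a + floorSum K q ≡ K * q) (dyadicFloor-self K a) (νPartial+floorSum≡n*dyadicFloor K a K)

-- ⌊log₂ (2 + m)⌋ unfolds to suc ⌊log₂ ⌊(2 + m)/2⌋⌋ up to the accessibility proof.
⌊log₂⌋-step : ∀ m → ⌊log₂ (2 + m) ⌋ ≡ suc ⌊log₂ ((2 + m) / 2) ⌋
⌊log₂⌋-step m = cong suc (trans (⌊log2⌋-acc-irrelevant (suc ⌊ m /2⌋)) (cong ⌊log₂_⌋ (⌊n/2⌋≡n/2 (2 + m))))
  where
  ⌊n/2⌋≡n/2 : ∀ n → ⌊ n /2⌋ ≡ n / 2
  ⌊n/2⌋≡n/2 zero          = refl
  ⌊n/2⌋≡n/2 (suc zero)    = refl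
  ⌊n/2⌋≡n/2 (suc (suc n)) = trans (cong suc (⌊n/2⌋≡n/2 n)) (sym (m/n≡1+[m∸n]/n {2 + n} (s≤s (s≤s z≤n))))

floorSum-bound-step : ∀ {q b h L F} → q ≡ b + h * 2 → b ≤ 1 → L * suc h < h + F →
                      suc L * suc q < q + (2 * F + 2 * h)
floorSum-bound-step {q} {b} {h} {L} {F} refl b≤1 ih = +-cancelʳ-≤ L _ _ (begin
  suc (suc L * suc q) + L                    ≡⟨ expand b h L ⟩
  2 * suc (L * suc h) + (b + h * 2 + b * L)  ≤⟨ +-mono-≤ (*-monoʳ-≤ 2 ih) (+-monoʳ-≤ (b + h * 2) bL≤L) ⟩
  2 * (h + F) + (b + h * 2 + L)              ≡⟨ regroup b h L F ⟩
  q + (2 * F + 2 * h) + L                    ∎)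
  where
  open ≤-Reasoning
  bL≤L : b * L ≤ L
  bL≤L = ≤-trans (*-monoˡ-≤ L b≤1) (≤-reflexive (+-identityʳ L))
  expand : ∀ b h L → suc (suc L * suc (b + h * 2)) + L ≡ 2 * suc (L * suc h) + (b + h * 2 + b * L)
  expand = solve-∀
  regroup : ∀ b h L F → 2 * (h + F) + (b + h * 2 + L) ≡ b + h * 2 + (2 * F + 2 * h) + L
  regroup = solve-∀

⌊log₂q⌋*[1+q]<q+floorSum : ∀ n q → 0 < q → ⌊log₂ q ⌋ ≤ n → ⌊log₂ q ⌋ * suc q < q + floorSum n q
⌊log₂q⌋*[1+q]<q+floorSum n       1               _ _   = s≤s z≤n
⌊log₂q⌋*[1+q]<q+floorSum zero    (suc (suc m))   _ ()
⌊log₂q⌋*[1+q]<q+floorSum (suc n) q@(suc (suc m)) _ L≤1+n =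
  subst (λ L → L * suc q < q + floorSum (suc n) q) (sym (⌊log₂⌋-step m))
    (floorSum-bound-step {L = ⌊log₂ h ⌋} {F = floorSum n h} (m≡m%n+[m/n]*n q 2) (≤-pred (m%n<n q 2)) bound-for-half)
  where
  h = q / 2
  bound-for-half : ⌊log₂ h ⌋ * suc h < h + floorSum n h
  bound-for-half = ⌊log₂q⌋*[1+q]<q+floorSum n h (m≥n⇒m/n>0 {q} (s≤s (s≤s z≤n)))
                     (≤-pred (subst (_≤ suc n) (⌊log₂⌋-step m) L≤1+n))

exponent-bound : ∀ {V S A K L} → V + S ≡ K * A → L * suc A < A + S → L ≤ K →
                 V + 2 * A < A * (K + 3 ∸ L)
exponent-bound {V} {S} {A} {K} {L} V+S≡K*A L*[1+A]<A+S L≤K with m≤n⇒∃[o]m+o≡n L≤K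
... | t , refl = subst (λ k → V + 2 * A < A * k) t+3≡K+3∸L
  (+-cancelʳ-≤ S _ _ (begin
    suc (V + 2 * A) + S          ≡⟨ swap V S A ⟩
    suc (V + S) + 2 * A          ≡⟨ cong (λ x → suc x + 2 * A) V+S≡K*A ⟩
    suc ((L + t) * A) + 2 * A    ≡⟨ split L t A ⟩
    suc (L * A) + A * (t + 2)    ≤⟨ +-monoˡ-≤ (A * (t + 2)) (≤-trans (s≤s (m≤n+m (L * A) L)) L+L*A<A+S) ⟩
    A + S + A * (t + 2)          ≡⟨ merge A S t ⟩
    A * (t + 3) + S              ∎))
  where
  open ≤-Reasoning
  t+3≡K+3∸L : t + 3 ≡ L + t + 3 ∸ L
  t+3≡K+3∸L = trans (sym (m+n∸m≡n L (t + 3))) (cong (_∸ L) (sym (+-assoc L t 3)))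
  L+L*A<A+S : L + L * A < A + S
  L+L*A<A+S = subst (_< A + S) (*-suc L A) L*[1+A]<A+S
  swap : ∀ V S A → suc (V + 2 * A) + S ≡ suc (V + S) + 2 * A
  swap = solve-∀
  split : ∀ L t A → suc ((L + t) * A) + 2 * A ≡ suc (L * A) + A * (t + 2)
  split = solve-∀
  merge : ∀ A S t → A + S + A * (t + 2) ≡ A * (t + 3) + S
  merge = solve-∀

νScaled+2*a<a*[K+3∸⌊log₂a⌋] : ∀ K a → 0 < a → a ≤ 2 ^ K → νScaled K a + 2 * a < a * (K + 3 ∸ ⌊log₂ a ⌋)
νScaled+2*a<a*[K+3∸⌊log₂a⌋] K a 0<a a≤2^K =
  exponent-bound (νScaled+floorSum≡K*a K a) (⌊log₂q⌋*[1+q]<q+floorSum K a 0<a ⌊log₂a⌋≤K) ⌊log₂a⌋≤K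
  where
  ⌊log₂a⌋≤K : ⌊log₂ a ⌋ ≤ K
  ⌊log₂a⌋≤K = subst (⌊log₂ a ⌋ ≤_) (⌊log₂[2^n]⌋≡n K) (⌊log₂⌋-mono-≤ a≤2^K)

-- Under 2n = m + 1 + a the right-hand side exceeds the left-hand side by exactly (m + 1)² + a.
[1+n]^m*a≤n^m*[2n+m]-step : ∀ n m a → suc m + a ≡ 2 * n →
                            (2 * n + m) * (suc n * a) ≤ n * (2 * n + suc m) * suc a
[1+n]^m*a≤n^m*[2n+m]-step n m a 1+m+a≡2n = begin
  (2 * n + m) * (suc n * a)             ≡⟨ cong (λ x → (x + m) * (suc n * a)) 1+m+a≡2n ⟨
  (suc m + a + m) * (suc n * a)         ≡⟨ expand-left n m a ⟩
  n * α + α                             ≤⟨ +-monoʳ-≤ (n * α) (m≤m+n α _) ⟩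
  n * α + (α + (suc m * suc m + a))     ≡⟨ cong (n * α +_) (square m a) ⟩
  n * α + (suc m + a) * (suc m + a)     ≡⟨ cong (λ x → n * α + x * (suc m + a)) 1+m+a≡2n ⟩
  n * α + 2 * n * (suc m + a)           ≡⟨ expand-right n m a ⟨
  n * (suc m + a + suc m) * suc a       ≡⟨ cong (λ x → n * (x + suc m) * suc a) 1+m+a≡2n ⟩
  n * (2 * n + suc m) * suc a           ∎
  where
  open ≤-Reasoning
  α = (suc m + a + m) * a
  expand-left : ∀ n m a → (suc m + a + m) * (suc n * a) ≡ n * ((suc m + a + m) * a) + (suc m + a + m) * a
  expand-left = solve-∀
  square : ∀ m a → (suc m + a + m) * a + (suc m * suc m + a) ≡ (suc m + a) * (suc m + a)
  square = solve-∀
  expand-right : ∀ n m a → n * (suc m + a + suc m) * suc a ≡ n * ((suc m + a + m) * a) + 2 * n * (suc m + a)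
  expand-right = solve-∀

[1+n]^m*a≤n^m*[2n+m] : ∀ n m a → m + a ≡ 2 * n → suc n ^ m * a ≤ n ^ m * (2 * n + m)
[1+n]^m*a≤n^m*[2n+m] n zero    a a≡2n = ≤-reflexive (cong (_+ 0) (trans a≡2n (sym (+-identityʳ (2 * n)))))
[1+n]^m*a≤n^m*[2n+m] n (suc m) a 1+m+a≡2n = *-cancelʳ-≤ _ _ (suc a) (begin
  suc n ^ suc m * a * suc a              ≡⟨ reorder (suc n) (suc n ^ m) a ⟩
  suc n * a * (suc n ^ m * suc a)        ≤⟨ *-monoʳ-≤ (suc n * a) ih ⟩
  suc n * a * (n ^ m * (2 * n + m))      ≡⟨ reorder′ (suc n * a) (n ^ m) (2 * n + m) ⟩
  n ^ m * ((2 * n + m) * (suc n * a))    ≤⟨ *-monoʳ-≤ (n ^ m) ([1+n]^m*a≤n^m*[2n+m]-step n m a 1+m+a≡2n) ⟩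
  n ^ m * (n * (2 * n + suc m) * suc a)  ≡⟨ reorder″ (n ^ m) n (2 * n + suc m) (suc a) ⟩
  n ^ suc m * (2 * n + suc m) * suc a    ∎)
  where
  open ≤-Reasoning
  ih : suc n ^ m * suc a ≤ n ^ m * (2 * n + m)
  ih = [1+n]^m*a≤n^m*[2n+m] n m (suc a) (trans (+-suc m a) 1+m+a≡2n)
  reorder : ∀ x y a → x * y * a * suc a ≡ x * a * (y * suc a)
  reorder = solve-∀
  reorder′ : ∀ x y z → x * (y * z) ≡ y * (z * x)
  reorder′ = solve-∀
  reorder″ : ∀ x y z w → x * (y * z * w) ≡ y * x * z * w
  reorder″ = solve-∀

[1+n]^m≤3*n^m : ∀ n m → m ≤ n → suc n ^ m ≤ 3 * n ^ m
[1+n]^m≤3*n^m zero    zero _ = s≤s z≤n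
[1+n]^m≤3*n^m n@(suc _) m m≤n with m≤n⇒∃[o]m+o≡n (≤-trans m≤n (m≤m+n n (n + 0)))
... | a , m+a≡2n = *-cancelʳ-≤ _ _ n (begin
  suc n ^ m * n          ≤⟨ *-monoʳ-≤ (suc n ^ m) n≤a ⟩
  suc n ^ m * a          ≤⟨ [1+n]^m*a≤n^m*[2n+m] n m a m+a≡2n ⟩
  n ^ m * (2 * n + m)    ≤⟨ *-monoʳ-≤ (n ^ m) (+-monoʳ-≤ (2 * n) m≤n) ⟩
  n ^ m * (2 * n + n)    ≡⟨ reorder (n ^ m) n ⟩
  3 * n ^ m * n          ∎)
  where
  open ≤-Reasoning
  n≤a : n ≤ a
  n≤a = +-cancelˡ-≤ n _ _ (subst (_≤ n + a) (trans m+a≡2n (cong (n +_) (+-identityʳ n))) (+-monoˡ-≤ a m≤n))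
  reorder : ∀ x n → x * (2 * n + n) ≡ 3 * x * n
  reorder = solve-∀

[m+a]^m≤3^a*m^m : ∀ m a → (m + a) ^ m ≤ 3 ^ a * m ^ m
[m+a]^m≤3^a*m^m m zero    = ≤-reflexive (trans (cong (_^ m) (+-identityʳ m)) (sym (+-identityʳ (m ^ m))))
[m+a]^m≤3^a*m^m m (suc a) = begin
  (m + suc a) ^ m    ≡⟨ cong (_^ m) (+-suc m a) ⟩
  suc (m + a) ^ m    ≤⟨ [1+n]^m≤3*n^m (m + a) m (m≤m+n m a) ⟩
  3 * (m + a) ^ m    ≤⟨ *-monoʳ-≤ 3 ([m+a]^m≤3^a*m^m m a) ⟩
  3 * (3 ^ a * m ^ m) ≡⟨ *-assoc 3 (3 ^ a) (m ^ m) ⟨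
  3 ^ suc a * m ^ m  ∎
  where open ≤-Reasoning

2^[m*K]≤2^[2a]*m^m : ∀ m a K → m + a ≡ 2 ^ K → 2 ^ (m * K) ≤ 2 ^ (2 * a) * m ^ m
2^[m*K]≤2^[2a]*m^m m a K m+a≡2^K = begin
  2 ^ (m * K)        ≡⟨ cong (2 ^_) (*-comm m K) ⟩
  2 ^ (K * m)        ≡⟨ ^-*-assoc 2 K m ⟨
  (2 ^ K) ^ m        ≡⟨ cong (_^ m) m+a≡2^K ⟨
  (m + a) ^ m        ≤⟨ [m+a]^m≤3^a*m^m m a ⟩
  3 ^ a * m ^ m      ≤⟨ *-monoˡ-≤ (m ^ m) (^-monoˡ-≤ a (n≤1+n 3)) ⟩
  4 ^ a * m ^ m      ≡⟨ cong (_* m ^ m) (^-*-assoc 2 2 a) ⟩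
  2 ^ (2 * a) * m ^ m ∎
  where open ≤-Reasoning

lemma4p17 : (M : ℕ) → .{{_ : NonZero M}} →
    let K  = ⌈log₂ M ⌉
        A₀ = 2 ^ K ∸ M
    in 0 < A₀ →
       2 ^ (M * K + νScaled K A₀) < M ^ M * 2 ^ (A₀ * (K + 3 ∸ ⌊log₂ A₀ ⌋))
lemma4p17 M 0<A = begin-strict
  2 ^ (M * K + V)                 ≡⟨ ^-distribˡ-+-* 2 (M * K) V ⟩
  2 ^ (M * K) * 2 ^ V             ≤⟨ *-monoˡ-≤ (2 ^ V) (2^[m*K]≤2^[2a]*m^m M A K M+A≡2^K) ⟩
  2 ^ (2 * A) * M ^ M * 2 ^ V     ≡⟨ reorder (2 ^ (2 * A)) (M ^ M) (2 ^ V) ⟩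
  M ^ M * (2 ^ V * 2 ^ (2 * A))   ≡⟨ cong (M ^ M *_) (^-distribˡ-+-* 2 V (2 * A)) ⟨
  M ^ M * 2 ^ (V + 2 * A)         <⟨ *-monoʳ-< (M ^ M) {{m^n≢0 M M}} (^-monoʳ-< 2 (s≤s (s≤s z≤n)) exponent<) ⟩
  M ^ M * 2 ^ (A * (K + 3 ∸ ⌊log₂ A ⌋)) ∎
  where
  open ≤-Reasoning
  K = ⌈log₂ M ⌉
  A = 2 ^ K ∸ M
  V = νScaled K A
  M+A≡2^K : M + A ≡ 2 ^ K
  M+A≡2^K = m+[n∸m]≡n (<⇒≤ (m∸n≢0⇒n<m {n = M} (λ A≡0 → <-irrefl (sym A≡0) 0<A)))
  exponent< : V + 2 * A < A * (K + 3 ∸ ⌊log₂ A ⌋)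
  exponent< = νScaled+2*a<a*[K+3∸⌊log₂a⌋] K A 0<A (subst (A ≤_) M+A≡2^K (m≤n+m A M))
  reorder : ∀ x y z → x * y * z ≡ y * (z * x)
  reorder = solve-∀
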